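{- Let $G$ be a well-partitioned chordal graph and let $H$ be its minimal split decomposition. Then every component of $H$ is a split graph.
   Context: All graphs are finite, simple and connected. A connected graph $G=(V,E)$ is a well-partitioned chordal graph if there exist a partition $\mathcal{P}$ of $V$ and a tree $\mathcal{T}$ whose vertex set is $\mathcal{P}$ (the elements of $\mathcal{P}$ are called bags) such that: (1) each bag is a clique of $G$; (2) for every edge $AB$ of $\mathcal{T}$ there exist $A'\subseteq A$, $B'\subseteq B$ such that the edges of $G$ between $A$ and $B$ are exactly the pairs in $A'\times B'$; (3) for distinct bags $A,B$ not adjacent in $\mathcal{T}$ there are no edges of $G$ between $A$ and $B$. A split graph is a graph whose vertex set can be partitioned into a clique and an independent set. For $X\subseteq V$, $N_G(X)=\bigcup_{x\in X}N_G(x)\setminus X$. A split of a connected graph $G=(V,E)$ is a bipartition $\{V_1,V_2\}$ of $V$ with $|V_1|\ge 2$, $|V_2|\ge 2$, such that every vertex of $N_G(V_1)$ is adjacent to every vertex of $N_G(V_2)$. A graph with no split is prime. Given a split $\{V_1,V_2\}$, one decomposes $G$ into the two split components $G_1$ and $G_2$, where $G_1$ is obtained from $G[V_1]$ by adding a new vertex $v_1$ adjacent to every vertex of $N_G(V_2)$ (which lies in $V_1$), and $G_2$ is obtained from $G[V_2]$ by adding a new vertex $v_2$ adjacent to every vertex of $N_G(V_1)$; the new vertices $v_1,v_2$ are marked as linked. Applying this recursively to components yields a split decomposition of $G$. A minimal split decomposition is a split decomposition all of whose components are cliques, stars or prime graphs and whose number of components is minimum; it is unique. -}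

module Defs where

open import Data.Nat using (ℕ; _≤_)
open import Data.Fin using (Fin)
open import Data.Bool using (Bool; true; false; not)
open import Data.List using (List; []; _∷_; _++_; length)
open import Data.List.Relation.Unary.All using (All)
open import Data.Product using (Σ; ∃; ∃-syntax; _×_; _,_)
open import Data.Sum using (_⊎_)
open import Data.Empty using (⊥)
open import Relation.Nullary using (¬_)
open import Relation.Binary.PropositionalEquality using (_≡_; _≢_)
open import Function.Bundles using (_⇔_)

record Graph : Set where
  field
    n      : ℕ
    adj    : Fin n → Fin n → Bool
    sym    : ∀ u v → adj u v ≡ adj v u
    irrefl : ∀ u → adj u u ≡ false

open Graph public

Adj : (G : Graph) → Fin (n G) → Fin (n G) → Set
Adj G u v = adj G u v ≡ true

data Walk {k : ℕ} (E : Fin k → Fin k → Set) : Fin k → Fin k → Set where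
  here : ∀ {u} → Walk E u u
  step : ∀ {u v w} → E u v → Walk E v w → Walk E u w

Connected : Graph → Set
Connected G = ∀ u v → Walk (Adj G) u v

AdjWithout : (G : Graph) → Fin (n G) → Fin (n G) → Fin (n G) → Fin (n G) → Set
AdjWithout G a b x y = Adj G x y × ¬ ((x ≡ a × y ≡ b) ⊎ (x ≡ b × y ≡ a))

-- A tree: a connected graph that is acyclic, i.e. every edge is a bridge
-- (minimally connected graph).
IsTree : Graph → Set
IsTree T = Connected T × (∀ a b → Adj T a b → ¬ Walk (AdjWithout T a b) a b)

-- Well-partitioned chordal graph: a partition of V into nonempty bags
-- (bag : V → V(T), surjective; bag u is the bag containing u) and a tree T
-- whose vertices are the bags.
WellPartitionedChordal : Graph → Set
WellPartitionedChordal G =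
  Σ Graph λ T → Σ (Fin (n G) → Fin (n T)) λ bag →
    (∀ A → ∃[ u ] bag u ≡ A)
    × IsTree T
    × (∀ u v → bag u ≡ bag v → u ≢ v → Adj G u v)
    × (∀ A B → Adj T A B →
         Σ (Fin (n G) → Bool) λ A' → Σ (Fin (n G) → Bool) λ B' →
           (∀ u → A' u ≡ true → bag u ≡ A)
           × (∀ v → B' v ≡ true → bag v ≡ B)
           × (∀ u v → bag u ≡ A → bag v ≡ B →
                (Adj G u v ⇔ (A' u ≡ true × B' v ≡ true))))
    × (∀ u v → bag u ≢ bag v → ¬ Adj T (bag u) (bag v) → ¬ Adj G u v)

IsSplitGraph : Graph → Set
IsSplitGraph G = Σ (Fin (n G) → Bool) λ K →
  (∀ u v → K u ≡ true → K v ≡ true → u ≢ v → Adj G u v)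
  × (∀ u v → K u ≡ false → K v ≡ false → ¬ Adj G u v)

InNbhd : (G : Graph) → (Fin (n G) → Bool) → Fin (n G) → Set
InNbhd G X u = X u ≡ false × ∃[ x ] (X x ≡ true × Adj G x u)

AtLeastTwo : ∀ {m} → (Fin m → Bool) → Set
AtLeastTwo X = ∃[ a ] ∃[ b ] (a ≢ b × X a ≡ true × X b ≡ true)

IsSplit : (G : Graph) → (Fin (n G) → Bool) → Set
IsSplit G V1 =
  AtLeastTwo V1 × AtLeastTwo (λ v → not (V1 v))
  × (∀ u v → InNbhd G V1 u → InNbhd G (λ w → not (V1 w)) v → Adj G u v)

IsPrime : Graph → Set
IsPrime G = ∀ V1 → ¬ IsSplit G V1

IsCompleteGraph : Graph → Set
IsCompleteGraph G = ∀ u v → u ≢ v → Adj G u v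

IsStar : Graph → Set
IsStar G = ∃[ c ] ((∀ v → v ≢ c → Adj G c v)
                   × (∀ u v → u ≢ c → v ≢ c → ¬ Adj G u v))

-- H is (isomorphic to) the split component G[V1] + marker vertex mk, where
-- mk is adjacent exactly to the vertices of V1 having a neighbour outside V1
-- (i.e. to N_G(V2) with V2 the complement of V1).
-- f : V(H)∖{mk} → V1 and g : V1 → V(H)∖{mk} are mutually inverse.
record SplitComponent (G : Graph) (V1 : Fin (n G) → Bool) (H : Graph) : Set where
  field
    mk      : Fin (n H)
    f       : Fin (n H) → Fin (n G)
    g       : Fin (n G) → Fin (n H)
    f-into  : ∀ x → x ≢ mk → V1 (f x) ≡ true
    gf      : ∀ x → x ≢ mk → g (f x) ≡ x
    g-avoid : ∀ v → V1 v ≡ true → g v ≢ mk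
    fg      : ∀ v → V1 v ≡ true → f (g v) ≡ v
    adj-old : ∀ x y → x ≢ mk → y ≢ mk → adj H x y ≡ adj G (f x) (f y)
    adj-mk  : ∀ x → x ≢ mk →
              (Adj H mk x ⇔ InNbhd G (λ w → not (V1 w)) (f x))

data SplitDecomposition : Graph → Set where
  leaf  : ∀ {G} → SplitDecomposition G
  node  : ∀ {G} (V1 : Fin (n G) → Bool) → IsSplit G V1 →
          (G1 G2 : Graph) →
          SplitComponent G V1 G1 → SplitComponent G (λ w → not (V1 w)) G2 →
          SplitDecomposition G1 → SplitDecomposition G2 →
          SplitDecomposition G

components : ∀ {G} → SplitDecomposition G → List Graph
components {G} leaf = G ∷ []
components (node _ _ _ _ _ _ D1 D2) = components D1 ++ components D2

CliqueStarOrPrime : Graph → Set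
CliqueStarOrPrime H = IsCompleteGraph H ⊎ IsStar H ⊎ IsPrime H

IsMinimalSplitDecomposition : (G : Graph) → SplitDecomposition G → Set
IsMinimalSplitDecomposition G D =
  All CliqueStarOrPrime (components D)
  × (∀ (D' : SplitDecomposition G) → All CliqueStarOrPrime (components D') →
       length (components D) ≤ length (components D'))

-- Every component of a split decomposition of a connected graph G is an
-- induced subgraph of G: the marker vertex of the component on the side V₁
-- can be played by any vertex of V₂ with a neighbour in V₁.  Cliques and
-- stars are split graphs, so it remains to see that a prime induced subgraph
-- C of a well-partitioned chordal graph is split.  Removing an edge ab of the
-- bag tree cuts C into the vertices whose bags lie on a's side and the rest;
-- condition (2) makes this bipartition satisfy the split condition, so as C
-- is prime one of the two sides holds at most one vertex of C.  Call such a
-- vertex cut off.  Two vertices that are not cut off cannot be separated by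
-- any tree edge, so they share a bag and are adjacent.  Two adjacent cut-off
-- vertices make up all of C; otherwise the cut-off vertices are independent.

module Submission where

open import Defs
open import Data.Bool using (Bool; true; false; not)
open import Data.Bool.Properties using (not-injective; not-involutive) renaming (_≟_ to _≟ᵇ_)
open import Data.Empty using (⊥-elim)
open import Data.Fin using (Fin; zero; suc)
open import Data.Fin.Properties using (_≟_; all?)
open import Data.Fin.Subset.Properties using (anySubset?)
open import Data.List.Relation.Unary.All as All using (All; _∷_; [])
open import Data.List.Relation.Unary.All.Properties using (++⁺)
open import Data.Nat using (ℕ)
open import Data.Product using (∃-syntax; _×_; _,_; proj₁; proj₂; swap)
open import Data.Sum as Sum using (_⊎_; inj₁; inj₂)
open import Data.Vec using (lookup; tabulate)
open import Data.Vec.Properties using (lookup∘tabulate)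
open import Effect.Monad using (RawMonad)
open import Function using (_∘_; id; Equivalence)
open import Function.Definitions using (Injective)
open import Level using (0ℓ)
open import Relation.Nullary using (¬_; Dec; yes; no; does)
open import Relation.Nullary.Decidable
  using (dec-true; decidable-stable; ¬¬-excluded-middle; ¬?; map′; _×-dec_; _⊎-dec_; _→-dec_)
open import Relation.Nullary.Negation using (¬¬-Monad)
open import Relation.Binary.PropositionalEquality
  using (_≡_; _≢_; refl; trans; cong; cong₂; subst; subst₂) renaming (sym to ≡-sym)

open RawMonad (¬¬-Monad {0ℓ})

does⇒ : ∀ {A : Set} (a? : Dec A) → does a? ≡ true → A
does⇒ (yes a) _  = a
does⇒ (no _)  ()

¬does⇒ : ∀ {A : Set} (a? : Dec A) → does a? ≡ false → ¬ A
¬does⇒ (yes _) ()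
¬does⇒ (no ¬a) _ = ¬a

true-iff⇒≡ : ∀ {x y : Bool} → (x ≡ true → y ≡ true) → (y ≡ true → x ≡ true) → x ≡ y
true-iff⇒≡ {false} {false} _ _ = refl
true-iff⇒≡ {false} {true}  _ g = g refl
true-iff⇒≡ {true}  {false} f _ = ≡-sym (f refl)
true-iff⇒≡ {true}  {true}  _ _ = refl

¬¬-decidable-on-Fin : ∀ {k} (P : Fin k → Set) → ¬ ¬ (∀ i → Dec (P i))
¬¬-decidable-on-Fin {ℕ.zero}  P = pure λ ()
¬¬-decidable-on-Fin {ℕ.suc k} P = do
  P₀? ← ¬¬-excluded-middle
  Pₛ? ← ¬¬-decidable-on-Fin (P ∘ suc)
  pure λ { zero → P₀? ; (suc i) → Pₛ? i }

adj-sym : (G : Graph) {u v : Fin (n G)} → Adj G u v → Adj G v u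
adj-sym G {u} {v} uv = trans (Graph.sym G v u) uv

adj-irrefl : (G : Graph) {u v : Fin (n G)} → Adj G u v → u ≢ v
adj-irrefl G {u} uv refl with () ← trans (≡-sym uv) (Graph.irrefl G u)

module _ {k : ℕ} {E : Fin k → Fin k → Set} where

  infixr 5 _◅◅_
  _◅◅_ : ∀ {u v w} → Walk E u v → Walk E v w → Walk E u w
  here     ◅◅ w′ = w′
  step e w ◅◅ w′ = step e (w ◅◅ w′)

  infixl 5 _▻_
  _▻_ : ∀ {u v w} → Walk E u v → E v w → Walk E u w
  w ▻ e = w ◅◅ step e here

  walk-reverse : (∀ {p q} → E p q → E q p) → ∀ {u v} → Walk E u v → Walk E v u
  walk-reverse E-sym here       = here
  walk-reverse E-sym (step e w) = walk-reverse E-sym w ▻ E-sym e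

walk-map : ∀ {k l} {E : Fin k → Fin k → Set} {E′ : Fin l → Fin l → Set} (h : Fin k → Fin l) →
           (∀ {p q} → E p q → E′ (h p) (h q)) → ∀ {u v} → Walk E u v → Walk E′ (h u) (h v)
walk-map h f here       = here
walk-map h f (step e w) = step (f e) (walk-map h f w)

module TreeSides (T : Graph) (tree : IsTree T) where

  Side : (a b x : Fin (n T)) → Set
  Side a b = Walk (AdjWithout T a b) a

  edge? : ∀ (a b x y : Fin (n T)) → Dec ((x ≡ a × y ≡ b) ⊎ (x ≡ b × y ≡ a))
  edge? a b x y = ((x ≟ a) ×-dec (y ≟ b)) ⊎-dec ((x ≟ b) ×-dec (y ≟ a))

  without-sym : ∀ {a b x y} → AdjWithout T a b x y → AdjWithout T a b y x
  without-sym (xy , ¬ab) = adj-sym T xy , ¬ab ∘ Sum.swap ∘ Sum.map swap swap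

  without-swap : ∀ {a b x y} → AdjWithout T a b x y → AdjWithout T b a x y
  without-swap (xy , ¬ab) = xy , ¬ab ∘ Sum.swap

  side-total : ∀ a b x → Side a b x ⊎ Side b a x
  side-total a b x = extend (proj₁ tree a x) (inj₁ here)
    where
    extend : ∀ {u} → Walk (Adj T) u x → Side a b u ⊎ Side b a u → Side a b x ⊎ Side b a x
    extend here s = s
    extend {u} (step {v = v} uv w) s with edge? a b u v
    ... | yes (inj₁ (_ , refl)) = extend w (inj₂ here)
    ... | yes (inj₂ (_ , refl)) = extend w (inj₁ here)
    ... | no ¬ab = extend w (Sum.map (_▻ (uv , ¬ab)) (_▻ without-swap (uv , ¬ab)) s)

  sides-disjoint : ∀ {a b x} → Adj T a b → Side a b x → ¬ Side b a x
  sides-disjoint ab a⇝x b⇝x =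
    proj₂ tree _ _ ab (a⇝x ◅◅ walk-reverse without-sym (walk-map id without-swap b⇝x))

  side-exit : ∀ {a b x y} → Adj T a b → Side a b x → ¬ Side a b y → Adj T x y → x ≡ a × y ≡ b
  side-exit {a} {b} {x} {y} ab a⇝x ¬a⇝y xy with edge? a b x y
  ... | yes (inj₁ xy≡ab)    = xy≡ab
  ... | yes (inj₂ (refl , _)) = ⊥-elim (proj₂ tree a b ab a⇝x)
  ... | no ¬ab              = ⊥-elim (¬a⇝y (a⇝x ▻ (xy , ¬ab)))

  last-edge : ∀ {u P} → Walk (Adj T) u P → u ≢ P → ∃[ z ] (Adj T P z × Walk (AdjWithout T P z) u z)
  last-edge here u≢P = ⊥-elim (u≢P refl)
  last-edge {u} {P} (step {v = v} uv w) u≢P with v ≟ P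
  ... | yes refl = u , adj-sym T uv , here
  ... | no v≢P with last-edge w v≢P
  ...   | z , Pz , v⇝z = z , Pz , step (uv , λ { (inj₁ (u≡P , _)) → u≢P u≡P ; (inj₂ (_ , v≡P)) → v≢P v≡P }) v⇝z

  -- The last edge zP of a walk from Q to P separates P from Q: a walk from P
  -- to Q avoiding it would continue to z and close a cycle.
  separating-edge : ∀ {P Q} → P ≢ Q → ∃[ a ] ∃[ b ] (Adj T a b × Side a b P × ¬ Side a b Q)
  separating-edge {P} {Q} P≢Q with last-edge (proj₁ tree Q P) (P≢Q ∘ ≡-sym)
  ... | z , Pz , Q⇝z = P , z , Pz , here , λ P⇝Q → proj₂ tree P z Pz (P⇝Q ◅◅ Q⇝z)

module WellPartitioned {G : Graph} (wpc : WellPartitionedChordal G) where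

  T : Graph
  T = proj₁ wpc

  bag : Fin (n G) → Fin (n T)
  bag = proj₁ (proj₂ wpc)

  tree : IsTree T
  tree = proj₁ (proj₂ (proj₂ (proj₂ wpc)))

  open TreeSides T tree public

  bag-clique : ∀ u v → bag u ≡ bag v → u ≢ v → Adj G u v
  bag-clique = proj₁ (proj₂ (proj₂ (proj₂ (proj₂ wpc))))

  adj⇒bags-adj : ∀ {u v} → Adj G u v → bag u ≢ bag v → Adj T (bag u) (bag v)
  adj⇒bags-adj {u} {v} uv bu≢bv = decidable-stable (adj T (bag u) (bag v) ≟ᵇ true)
    λ ¬adj → proj₂ (proj₂ (proj₂ (proj₂ (proj₂ (proj₂ wpc))))) u v bu≢bv ¬adj uv

  adjacent-bags-join : ∀ {a b x u v y} → Adj T a b →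
                       bag x ≡ a → bag u ≡ b → Adj G x u →
                       bag v ≡ a → bag y ≡ b → Adj G v y → Adj G x y
  adjacent-bags-join {a} {b} {x} {u} {v} {y} ab bx bu xu bv by vy
    with proj₁ (proj₂ (proj₂ (proj₂ (proj₂ (proj₂ wpc))))) a b ab
  ... | _ , _ , _ , _ , joined = Equivalence.from (joined x y bx by)
          (proj₁ (Equivalence.to (joined x u bx bu) xu) , proj₂ (Equivalence.to (joined v y bv by) vy))

  Crossing : (a b : Fin (n T)) (p q : Fin (n G)) → Set
  Crossing a b p q = Side a b (bag p) × ¬ Side a b (bag q) × Adj G p q

  crossing-ends : ∀ {a b p q} → Adj T a b → Crossing a b p q → bag p ≡ a × bag q ≡ b
  crossing-ends ab (a⇝p , ¬a⇝q , pq) =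
    side-exit ab a⇝p ¬a⇝q (adj⇒bags-adj pq λ bp≡bq → ¬a⇝q (subst (Side _ _) bp≡bq a⇝p))

  crossings-complete : ∀ {a b x u v y} → Adj T a b → Crossing a b x u → Crossing a b v y → Adj G x y
  crossings-complete ab xu vy with crossing-ends ab xu | crossing-ends ab vy
  ... | bx , bu | bv , by = adjacent-bags-join ab bx bu (proj₂ (proj₂ xu)) bv by (proj₂ (proj₂ vy))

record InducedEmbedding (H G : Graph) : Set where
  field
    embed     : Fin (n H) → Fin (n G)
    injective : Injective _≡_ _≡_ embed
    adj-embed : ∀ x y → adj H x y ≡ adj G (embed x) (embed y)

  adj⇒ : ∀ {x y} → Adj H x y → Adj G (embed x) (embed y)
  adj⇒ {x} {y} xy = trans (≡-sym (adj-embed x y)) xy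

  adj⇐ : ∀ {x y} → Adj G (embed x) (embed y) → Adj H x y
  adj⇐ {x} {y} xy = trans (adj-embed x y) xy

open InducedEmbedding

id-embedding : ∀ {G} → InducedEmbedding G G
id-embedding = record { embed = id ; injective = id ; adj-embed = λ _ _ → refl }

infixr 9 _∘ᵉ_
_∘ᵉ_ : ∀ {H G K} → InducedEmbedding G K → InducedEmbedding H G → InducedEmbedding H K
ι ∘ᵉ κ = record
  { embed     = embed ι ∘ embed κ
  ; injective = injective κ ∘ injective ι
  ; adj-embed = λ x y → trans (adj-embed κ x y) (adj-embed ι (embed κ x) (embed κ y))
  }

IsSplitPartition : (C : Graph) → (Fin (n C) → Bool) → Set
IsSplitPartition C K = (∀ u v → K u ≡ true → K v ≡ true → u ≢ v → Adj C u v)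
                     × (∀ u v → K u ≡ false → K v ≡ false → ¬ Adj C u v)

isSplitPartition? : ∀ C K → Dec (IsSplitPartition C K)
isSplitPartition? C K =
  all? (λ u → all? λ v → (K u ≟ᵇ true) →-dec (K v ≟ᵇ true) →-dec ¬? (u ≟ v) →-dec (adj C u v ≟ᵇ true))
  ×-dec all? (λ u → all? λ v → (K u ≟ᵇ false) →-dec (K v ≟ᵇ false) →-dec ¬? (adj C u v ≟ᵇ true))

isSplitPartition-resp : ∀ {C K K′} → (∀ u → K u ≡ K′ u) → IsSplitPartition C K → IsSplitPartition C K′
isSplitPartition-resp K≗K′ (clique , indep) =
  (λ u v Ku Kv → clique u v (trans (K≗K′ u) Ku) (trans (K≗K′ v) Kv)) ,
  (λ u v Ku Kv → indep u v (trans (K≗K′ u) Ku) (trans (K≗K′ v) Kv))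

isSplitGraph? : ∀ C → Dec (IsSplitGraph C)
isSplitGraph? C = map′
  (λ (s , split) → lookup s , split)
  (λ (K , split) → tabulate K , isSplitPartition-resp {C} (≡-sym ∘ lookup∘tabulate K) split)
  (anySubset? (isSplitPartition? C ∘ lookup))

complete⇒split : ∀ C → IsCompleteGraph C → IsSplitGraph C
complete⇒split C complete = (λ _ → true) , (λ u v _ _ → complete u v) , λ _ _ ()

one-vertex-cover⇒split : ∀ C (c : Fin (n C)) → (∀ u v → u ≢ c → v ≢ c → ¬ Adj C u v) → IsSplitGraph C
one-vertex-cover⇒split C c cover =
  (λ v → does (v ≟ c)) ,
  (λ u v u≡c v≡c u≢v → ⊥-elim (u≢v (trans (does⇒ (u ≟ c) u≡c) (≡-sym (does⇒ (v ≟ c) v≡c))))) ,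
  (λ u v u≢c v≢c → cover u v (¬does⇒ (u ≟ c) u≢c) (¬does⇒ (v ≟ c) v≢c))

star⇒split : ∀ C → IsStar C → IsSplitGraph C
star⇒split C (c , _ , leaves-indep) = one-vertex-cover⇒split C c leaves-indep

covered-by-two⇒split : ∀ C (x y : Fin (n C)) → (∀ z → z ≡ x ⊎ z ≡ y) → IsSplitGraph C
covered-by-two⇒split C x y cover =
  one-vertex-cover⇒split C x λ u v u≢x v≢x uv → adj-irrefl C uv (trans (≡y u u≢x) (≡-sym (≡y v v≢x)))
  where
  ≡y : ∀ z → z ≢ x → z ≡ y
  ≡y z z≢x = Sum.[ ⊥-elim ∘ z≢x , id ]′ (cover z)

module PrimeInduced {G C : Graph} (wpc : WellPartitionedChordal G)
                    (ι : InducedEmbedding C G) (prime : IsPrime C) where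

  open WellPartitioned {G} wpc

  β : Fin (n C) → Fin (n T)
  β = bag ∘ embed ι

  OnSide : (a b : Fin (n T)) → Fin (n C) → Set
  OnSide a b z = Side a b (β z)

  TwoOf : (Fin (n C) → Set) → Set
  TwoOf P = ∃[ u ] ∃[ v ] (u ≢ v × P u × P v)

  cut-is-split : ∀ {a b} → Adj T a b → (side? : ∀ z → Dec (OnSide a b z)) →
                 ∀ u v → InNbhd C (does ∘ side?) u → InNbhd C (not ∘ does ∘ side?) v → Adj C u v
  cut-is-split ab side? u v (u∉ , x , x∈ , xu) (v∈ , y , y∉ , yv) =
    adj-sym C (adj⇐ ι (crossings-complete ab
      (decidable-stable (side? v) (¬does⇒ (¬? (side? v)) v∈) , does⇒ (¬? (side? y)) y∉ , adj⇒ ι (adj-sym C yv))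
      (does⇒ (side? x) x∈ , ¬does⇒ (side? u) u∉ , adj⇒ ι xu)))

  cut-unbalanced : ∀ {a b} → Adj T a b → ¬ (TwoOf (OnSide a b) × TwoOf (OnSide b a))
  cut-unbalanced {a} {b} ab ((u , v , u≢v , a⇝u , a⇝v) , (u′ , v′ , u′≢v′ , b⇝u′ , b⇝v′)) =
    ¬¬-decidable-on-Fin (OnSide a b) λ side? → prime (does ∘ side?)
      ( (u , v , u≢v , dec-true (side? u) a⇝u , dec-true (side? v) a⇝v)
      , (u′ , v′ , u′≢v′ , dec-true (¬? (side? u′)) (sides-disjoint (adj-sym T ab) b⇝u′)
                         , dec-true (¬? (side? v′)) (sides-disjoint (adj-sym T ab) b⇝v′))
      , cut-is-split ab side? )

  CutOff : Fin (n C) → Set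
  CutOff z = ∃[ a ] ∃[ b ] (Adj T a b × OnSide a b z × ∀ w → OnSide a b w → w ≡ z)

  ¬cutOff⇒¬¬two : ∀ {a b u} → ¬ CutOff u → Adj T a b → OnSide a b u → ¬ ¬ TwoOf (OnSide a b)
  ¬cutOff⇒¬¬two {a} {b} {u} ¬cut ab a⇝u ¬two = ¬cut (a , b , ab , a⇝u ,
    λ w a⇝w → decidable-stable (w ≟ u) λ w≢u → ¬two (w , u , w≢u , a⇝w , a⇝u))

  ¬cutOff⇒same-bag : ∀ {u v} → ¬ CutOff u → ¬ CutOff v → β u ≡ β v
  ¬cutOff⇒same-bag {u} {v} ¬cut-u ¬cut-v = decidable-stable (β u ≟ β v) λ βu≢βv →
    let a , b , ab , a⇝u , ¬a⇝v = separating-edge βu≢βv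
        b⇝v = Sum.[ ⊥-elim ∘ ¬a⇝v , id ]′ (side-total a b (β v))
    in ¬cutOff⇒¬¬two ¬cut-u ab a⇝u λ two-a →
       ¬cutOff⇒¬¬two ¬cut-v (adj-sym T ab) b⇝v λ two-b →
       cut-unbalanced ab (two-a , two-b)

  -- As x is alone on a's side of ab, the edge xy crosses ab, so β x ≡ a and
  -- β y ≡ b; symmetrically β y ≡ c and β x ≡ d, so cd is ba and y is alone on b's side.
  adjacent-cutOff-cover : ∀ {x y} → CutOff x → CutOff y → Adj C x y → ∀ z → z ≡ x ⊎ z ≡ y
  adjacent-cutOff-cover {x} {y} (a , b , ab , a⇝x , only-x) (c , d , cd , c⇝y , only-y) xy z
    with crossing-ends ab (a⇝x , (λ a⇝y → adj-irrefl C xy (≡-sym (only-x y a⇝y))) , adj⇒ ι xy)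
       | crossing-ends cd (c⇝y , (λ c⇝x → adj-irrefl C xy (only-y x c⇝x)) , adj⇒ ι (adj-sym C xy))
  ... | βx≡a , βy≡b | βy≡c , βx≡d =
    Sum.map (only-x z) (only-y z ∘ subst₂ (λ p q → Side p q (β z)) b≡c a≡d) (side-total a b (β z))
    where
    b≡c : b ≡ c
    b≡c = trans (≡-sym βy≡b) βy≡c
    a≡d : a ≡ d
    a≡d = trans (≡-sym βx≡a) βx≡d

  -- The argument is classical, which is harmless as being split is decidable.
  prime⇒split : IsSplitGraph C
  prime⇒split = decidable-stable (isSplitGraph? C) do
    cutOff? ← ¬¬-decidable-on-Fin CutOff
    pair? ← ¬¬-excluded-middle {A = ∃[ x ] ∃[ y ] (CutOff x × CutOff y × Adj C x y)}
    pure (split cutOff? pair?)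
    where
    split : (∀ z → Dec (CutOff z)) → Dec (∃[ x ] ∃[ y ] (CutOff x × CutOff y × Adj C x y)) → IsSplitGraph C
    split _ (yes (x , y , cut-x , cut-y , xy)) = covered-by-two⇒split C x y (adjacent-cutOff-cover cut-x cut-y xy)
    split cutOff? (no ¬pair) = (λ z → does (¬? (cutOff? z))) , clique , indep
      where
      clique : ∀ u v → does (¬? (cutOff? u)) ≡ true → does (¬? (cutOff? v)) ≡ true → u ≢ v → Adj C u v
      clique u v ¬cut-u ¬cut-v u≢v = adj⇐ ι (bag-clique _ _
        (¬cutOff⇒same-bag (does⇒ (¬? (cutOff? u)) ¬cut-u) (does⇒ (¬? (cutOff? v)) ¬cut-v))
        (u≢v ∘ injective ι))
      indep : ∀ u v → does (¬? (cutOff? u)) ≡ false → does (¬? (cutOff? v)) ≡ false → ¬ Adj C u v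
      indep u v cut-u cut-v uv = ¬pair (u , v ,
        decidable-stable (cutOff? u) (¬does⇒ (¬? (cutOff? u)) cut-u) ,
        decidable-stable (cutOff? v) (¬does⇒ (¬? (cutOff? v)) cut-v) , uv)

cliqueStarOrPrime⇒split : ∀ {G C} → WellPartitionedChordal G → InducedEmbedding C G →
                          CliqueStarOrPrime C → IsSplitGraph C
cliqueStarOrPrime⇒split {C = C} wpc ι (inj₁ complete)     = complete⇒split C complete
cliqueStarOrPrime⇒split {C = C} wpc ι (inj₂ (inj₁ star))  = star⇒split C star
cliqueStarOrPrime⇒split wpc ι (inj₂ (inj₂ prime)) = PrimeInduced.prime⇒split wpc ι prime

IsSplit-complement : ∀ {G W} → IsSplit G W → IsSplit G (not ∘ W)
IsSplit-complement {G} {W} ((a , b , a≢b , a∈ , b∈) , outside-two , complete) =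
  outside-two ,
  (a , b , a≢b , trans (not-involutive (W a)) a∈ , trans (not-involutive (W b)) b∈) ,
  λ u v u∈N v∈N → adj-sym G (complete v u (double-not v∈N) u∈N)
  where
  double-not : ∀ {v} → InNbhd G (not ∘ not ∘ W) v → InNbhd G W v
  double-not {v} (v∉ , x , x∈ , xv) =
    trans (≡-sym (not-involutive (W v))) v∉ , x , trans (≡-sym (not-involutive (W x))) x∈ , xv

module SplitComponentOf {G H : Graph} {W : Fin (n G) → Bool}
                        (conn : Connected G) (split : IsSplit G W) (sc : SplitComponent G W H) where

  open SplitComponent sc

  AdjIn : Fin (n G) → Fin (n G) → Set
  AdjIn p q = Adj G p q × W p ≡ true × W q ≡ true

  leave : ∀ {u v} → Walk (Adj G) u v → W u ≡ true → W v ≡ false →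
          ∃[ w ] ∃[ w′ ] (Walk AdjIn u w × Adj G w w′ × W w ≡ true × W w′ ≡ false)
  leave here u∈ v∉ with () ← trans (≡-sym u∈) v∉
  leave {u} (step {v = v} uv w) u∈ z∉ with W v in v∈W
  ... | false = u , v , here , uv , u∈ , v∈W
  ... | true with leave w v∈W z∉
  ...   | x , x′ , v⇝x , xx′ , x∈ , x′∉ = x , x′ , step (uv , u∈ , v∈W) v⇝x , xx′ , x∈ , x′∉

  marker-image : ∃[ y ] InNbhd G W y
  marker-image = exit (proj₁ split) (proj₁ (proj₂ split))
    where
    exit : AtLeastTwo W → AtLeastTwo (not ∘ W) → ∃[ y ] InNbhd G W y
    exit (a , _ , _ , a∈ , _) (b , _ , _ , b∉ , _) with leave (conn a b) a∈ (not-injective {y = false} b∉)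
    ... | x , y , _ , xy , x∈ , y∉ = y , y∉ , x , x∈ , xy

  y : Fin (n G)
  y = proj₁ marker-image

  y∈N : InNbhd G W y
  y∈N = proj₂ marker-image

  marker-adj : ∀ z → z ≢ mk → adj H mk z ≡ adj G y (f z)
  marker-adj z z≢mk = true-iff⇒≡
    (λ mk-z → proj₂ (proj₂ split) y (f z) y∈N (Equivalence.to (adj-mk z z≢mk) mk-z))
    (λ y-fz → Equivalence.from (adj-mk z z≢mk) (cong not (f-into z z≢mk) , y , cong not (proj₁ y∈N) , y-fz))

  y≢f : ∀ z → z ≢ mk → y ≢ f z
  y≢f z z≢mk y≡fz with () ← trans (≡-sym (proj₁ y∈N)) (trans (cong W y≡fz) (f-into z z≢mk))

  to-G : Fin (n H) → Fin (n G)
  to-G z with z ≟ mk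
  ... | yes _ = y
  ... | no _  = f z

  to-G-injective : ∀ x z → to-G x ≡ to-G z → x ≡ z
  to-G-injective x z same-image with x ≟ mk | z ≟ mk
  ... | yes refl | yes refl = refl
  ... | yes refl | no z≢mk  = ⊥-elim (y≢f z z≢mk same-image)
  ... | no x≢mk  | yes refl = ⊥-elim (y≢f x x≢mk (≡-sym same-image))
  ... | no x≢mk  | no z≢mk  = trans (≡-sym (gf x x≢mk)) (trans (cong g same-image) (gf z z≢mk))

  to-G-adj : ∀ x z → adj H x z ≡ adj G (to-G x) (to-G z)
  to-G-adj x z with x ≟ mk | z ≟ mk
  ... | yes refl | yes refl = trans (Graph.irrefl H mk) (≡-sym (Graph.irrefl G y))
  ... | yes refl | no z≢mk  = marker-adj z z≢mk
  ... | no x≢mk  | yes refl = trans (Graph.sym H x mk) (trans (marker-adj x x≢mk) (Graph.sym G y (f x)))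
  ... | no x≢mk  | no z≢mk  = adj-old x z x≢mk z≢mk

  embedding : InducedEmbedding H G
  embedding = record { embed = to-G ; injective = to-G-injective _ _ ; adj-embed = to-G-adj }

  g-adj : ∀ {p q} → AdjIn p q → Adj H (g p) (g q)
  g-adj {p} {q} (pq , p∈ , q∈) =
    trans (adj-old (g p) (g q) (g-avoid p p∈) (g-avoid q q∈)) (trans (cong₂ (adj G) (fg p p∈) (fg q q∈)) pq)

  to-marker : ∀ x → Walk (Adj H) x mk
  to-marker x with x ≟ mk
  ... | yes refl = here
  ... | no x≢mk with leave (conn (f x) y) (f-into x x≢mk) (proj₁ y∈N)
  ...   | w , w′ , fx⇝w , ww′ , w∈ , w′∉ =
    subst (λ s → Walk (Adj H) s (g w)) (gf x x≢mk) (walk-map g g-adj fx⇝w)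
    ▻ adj-sym H (Equivalence.from (adj-mk (g w) (g-avoid w w∈))
        (cong not (trans (cong W (fg w w∈)) w∈) , w′ , cong not w′∉ ,
         subst (Adj G w′) (≡-sym (fg w w∈)) (adj-sym G ww′)))

  connected : Connected H
  connected u v = to-marker u ◅◅ walk-reverse (adj-sym H) (to-marker v)

components-embed : ∀ {G} → Connected G → (D : SplitDecomposition G) →
                   All (λ H → InducedEmbedding H G) (components D)
components-embed conn leaf = id-embedding ∷ []
components-embed {G} conn (node W split G₁ G₂ sc₁ sc₂ D₁ D₂) =
  ++⁺ (All.map (C₁.embedding ∘ᵉ_) (components-embed C₁.connected D₁))
      (All.map (C₂.embedding ∘ᵉ_) (components-embed C₂.connected D₂))
  where
  module C₁ = SplitComponentOf conn split sc₁
  module C₂ = SplitComponentOf conn (IsSplit-complement {G} {W} split) sc₂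

theorem1 : (G : Graph) → Connected G → WellPartitionedChordal G →
           (H : SplitDecomposition G) → IsMinimalSplitDecomposition G H →
           All IsSplitGraph (components H)
theorem1 G conn wpc H (cliqueStarOrPrime , _) =
  All.zipWith (λ (c , ι) → cliqueStarOrPrime⇒split wpc ι c) (cliqueStarOrPrime , components-embed conn H)
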